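{- Let $G$ be an $(S_{1,2,2},N)$-free graph, let $x,y\in V(G)$ with $dist_G(x,y)\geq 4$, and let $P: x=v_0,v_1,\dots,v_k=y$ be a shortest $(x,y)$-path in $G$. Define, for $z\in V(G)\setminus V(P)$ and $N_P(z)=N_G(z)\cap V(P)$: $A_i=\{z\in V(G)\setminus V(P): N_P(z)=\{v_i\}\}$ for $i=0,1,k-1,k$; $L_i=\{z: N_P(z)=\{v_{i-1},v_{i+1}\}\}$ for $1\leq i\leq k-1$; $M_i=\{z: N_P(z)=\{v_{i-1},v_i\}\}$ for $1\leq i\leq k$; $N_i=\{z: N_P(z)=\{v_{i-1},v_i,v_{i+1}\}\}$ for $1\leq i\leq k-1$ (all with $z\in V(G)\setminus V(P)$); $S=V(P)\cup N_G(V(P))$ and $R=V(G)\setminus S$. Then (i) $N_G(M_i)\subset S$ for $i=2,\dots,k-1$; (ii) $N_G(N_i)\subset S$ for $i=2,\dots,k-2$; (iii) $N_G(L_i)\subset S$ for $i=1,\dots,k-1$; (iv) $N_P(R)=\emptyset$; (v) $N_S(R)\subset A_0\cup M_1\cup N_1\cup N_{k-1}\cup M_k\cup A_k$, where $N_S(R)=N_G(R)\cap S$.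
   Context: All graphs are simple, finite, undirected. $N_G(T)$ for a vertex set $T$ denotes the set of vertices at distance exactly 1 from $T$ (i.e., not in $T$ but adjacent to some vertex of $T$); $N_G(z)=N_G(\{z\})$. $G$ is $(S_{1,2,2},N)$-free if it has no induced subgraph isomorphic to $S_{1,2,2}$ or $N$, where $S_{1,2,2}$ is obtained by identifying one endvertex from each of three vertex-disjoint paths of lengths $1,2,2$, and $N$ (the net) is obtained by attaching a pendant edge to each vertex of a triangle. -}

module Defs where

open import Data.Nat using (ℕ; zero; suc; _≤_; _<_; _∸_)
open import Data.Fin using (Fin; _≟_) renaming (zero to f0; suc to fs)
open import Data.Bool using (Bool; true; false; _∧_; _∨_)
open import Data.List using (List; []; _∷_)
open import Data.Bool.ListAction using (any)
open import Data.Product using (Σ; ∃; _×_; _,_)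
open import Data.Sum using (_⊎_)
open import Data.Empty using (⊥)
open import Relation.Nullary using (¬_)
open import Relation.Nullary.Decidable using (⌊_⌋)
open import Relation.Binary.PropositionalEquality using (_≡_)
open import Function.Definitions using (Injective)

record Graph : Set where
  field
    n      : ℕ
    adj    : Fin n → Fin n → Bool
    adj-sym    : ∀ u w → adj u w ≡ adj w u
    adj-irrefl : ∀ u → adj u u ≡ false

  V : Set
  V = Fin n

  Adj : V → V → Set
  Adj u w = adj u w ≡ true

open Graph public

fromEdges : {m : ℕ} → List (Fin m × Fin m) → Fin m → Fin m → Bool
fromEdges es i j = any (λ { (a , b) → (⌊ a ≟ i ⌋ ∧ ⌊ b ≟ j ⌋) ∨ (⌊ a ≟ j ⌋ ∧ ⌊ b ≟ i ⌋) }) es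

HasInduced : (G : Graph) (m : ℕ) → (Fin m → Fin m → Bool) → Set
HasInduced G m H =
  Σ (Fin m → V G) λ f → Injective _≡_ _≡_ f × (∀ i j → adj G (f i) (f j) ≡ H i j)

private
  c0 c1 c2 c3 c4 c5 : Fin 6
  c0 = f0
  c1 = fs f0
  c2 = fs (fs f0)
  c3 = fs (fs (fs f0))
  c4 = fs (fs (fs (fs f0)))
  c5 = fs (fs (fs (fs (fs f0))))

S122 : Fin 6 → Fin 6 → Bool
S122 = fromEdges ((c0 , c1) ∷ (c0 , c2) ∷ (c2 , c3) ∷ (c0 , c4) ∷ (c4 , c5) ∷ [])

Net : Fin 6 → Fin 6 → Bool
Net = fromEdges ((c0 , c1) ∷ (c1 , c2) ∷ (c0 , c2) ∷ (c0 , c3) ∷ (c1 , c4) ∷ (c2 , c5) ∷ [])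

S122N-free : Graph → Set
S122N-free G = ¬ HasInduced G 6 S122 × ¬ HasInduced G 6 Net

data Walk (G : Graph) : V G → V G → ℕ → Set where
  nil  : ∀ {u} → Walk G u u 0
  cons : ∀ {u w t l} → Adj G u w → Walk G w t l → Walk G u t (suc l)

-- dist_G(x,y) ≥ d  (no walk of length < d; includes the disconnected case)
DistAtLeast : (G : Graph) → V G → V G → ℕ → Set
DistAtLeast G x y d = ∀ l → Walk G x y l → d ≤ l

-- v_0, ..., v_k (entries v i for i > k are irrelevant) is a shortest (x,y)-path.
IsShortestPath : (G : Graph) → V G → V G → (k : ℕ) → (ℕ → V G) → Set
IsShortestPath G x y k v =
  (v 0 ≡ x) × (v k ≡ y)
  × (∀ i → i < k → Adj G (v i) (v (suc i)))
  × (∀ i j → i ≤ k → j ≤ k → v i ≡ v j → i ≡ j)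
  × (∀ l → Walk G x y l → k ≤ l)

module PathSets (G : Graph) (k : ℕ) (v : ℕ → V G) where

  VSet : Set₁
  VSet = V G → Set

  OnP : VSet
  OnP w = ∃ λ i → i ≤ k × v i ≡ w

  NG : VSet → VSet
  NG T w = ¬ T w × (∃ λ t → T t × Adj G w t)

  NPis : V G → VSet → Set
  NPis z X = ¬ OnP z × (∀ w → ((OnP w × Adj G z w) → X w) × (X w → (OnP w × Adj G z w)))

  A : ℕ → VSet
  A i z = NPis z (λ w → w ≡ v i)

  L : ℕ → VSet
  L i z = NPis z (λ w → w ≡ v (i ∸ 1) ⊎ w ≡ v (suc i))

  M : ℕ → VSet
  M i z = NPis z (λ w → w ≡ v (i ∸ 1) ⊎ w ≡ v i)

  N : ℕ → VSet
  N i z = NPis z (λ w → w ≡ v (i ∸ 1) ⊎ w ≡ v i ⊎ w ≡ v (suc i))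

  S : VSet
  S w = OnP w ⊎ NG OnP w

  R : VSet
  R w = ¬ S w

  _⊆_ : VSet → VSet → Set
  X ⊆ Y = ∀ w → X w → Y w

-- Since P is shortest, a vertex z off P sees at most three consecutive vertices of P, so z lies in
-- some A_a, M_i, L_i or N_i. If moreover z has a neighbour t with no neighbour on P, then t, z and a
-- few path vertices near the neighbours of z induce S_{1,2,2} (centred at a path vertex seen by z, or
-- at z when z sees v_{i-1} and v_{i+1}) or a net (when z sees an edge v_{i-1} v_i). Only near the two
-- ends of P is there not enough room for this, which leaves the exceptions in (v).

module Submission where

open import Defs
open import Data.Nat using (ℕ; zero; suc; _+_; _∸_; _≤_; _<_; z≤n; s≤s; _≤?_)
open import Data.Nat.Properties
  using (≤-refl; ≤-reflexive; ≮⇒≥; <-irrefl; ≤-trans; ≤-antisym; <⇒≤; ≰⇒>; m≤n+m; m+n≤o⇒n≤o;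
         m∸n+n≡m; m+[n∸m]≡n; ∸-+-assoc; +-assoc; +-comm; +-cancelʳ-≤; anyUpTo?; module ≤-Reasoning)
open import Data.Nat.Induction using (<-rec)
open import Data.Fin using (Fin; suc)
import Data.Fin as Fin
open import Data.Fin.Patterns using (0F; 1F; 2F; 3F; 4F; 5F)
open import Data.Fin.Properties using (<-cmp; all?; any?)
open import Data.Vec using ([]; _∷_; lookup)
open import Data.Bool using (Bool; true; false)
import Data.Bool.Properties as Bool
open import Data.Product using (_×_; _,_; proj₁; proj₂; ∃)
open import Data.Sum using (_⊎_; inj₁; inj₂; [_,_])
open import Data.Empty using (⊥; ⊥-elim)
open import Data.Unit using (tt)
open import Relation.Binary using (tri<; tri≈; tri>)
open import Relation.Nullary using (¬_; Dec; yes; no; ¬?)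
open import Relation.Nullary.Decidable using (_×-dec_; _⊎-dec_; toWitness)
open import Relation.Unary using (Pred; Decidable)
open import Relation.Binary.PropositionalEquality hiding ([_])
open import Function using (_∘′_)

module _ {p} {P : Pred ℕ p} (P? : Decidable P) where

  LeastWitnessUpTo : ℕ → Set p
  LeastWitnessUpTo u = ∃ λ a → a ≤ u × P a × (∀ {i} → i < a → ¬ P i)

  least : ∀ {u} → P u → LeastWitnessUpTo u
  least {u} = <-rec (λ u → P u → LeastWitnessUpTo u) step u
    where
    step : ∀ u → (∀ {i} → i < u → P i → LeastWitnessUpTo i) → P u → LeastWitnessUpTo u
    step u rec Pu with anyUpTo? P? u
    ... | yes (i , i<u , Pi) = let a , a≤i , Pa , minimal = rec i<u Pi in a , ≤-trans a≤i (<⇒≤ i<u) , Pa , minimal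
    ... | no none = u , ≤-refl , Pu , λ i<u Pi → none (_ , i<u , Pi)

m≤n≤2+m : ∀ {m n} → m ≤ n → n ≤ 2 + m → n ≡ m ⊎ n ≡ 1 + m ⊎ n ≡ 2 + m
m≤n≤2+m {zero} {zero} _ _ = inj₁ refl
m≤n≤2+m {zero} {1} _ _ = inj₂ (inj₁ refl)
m≤n≤2+m {zero} {2} _ _ = inj₂ (inj₂ refl)
m≤n≤2+m {zero} {suc (suc (suc _))} _ (s≤s (s≤s ()))
m≤n≤2+m {suc m} {suc n} (s≤s m≤n) (s≤s n≤2+m) with m≤n≤2+m m≤n n≤2+m
... | inj₁ refl = inj₁ refl
... | inj₂ (inj₁ refl) = inj₂ (inj₁ refl)
... | inj₂ (inj₂ refl) = inj₂ (inj₂ refl)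

m+n≤o⇒n≤o∸m : ∀ m {n o} → m + n ≤ o → n ≤ o ∸ m
m+n≤o⇒n≤o∸m zero h = h
m+n≤o⇒n≤o∸m (suc m) (s≤s h) = m+n≤o⇒n≤o∸m m h

n≤o∸m⇒m+n≤o : ∀ {m n o} → m ≤ o → n ≤ o ∸ m → m + n ≤ o
n≤o∸m⇒m+n≤o z≤n h = h
n≤o∸m⇒m+n≤o (s≤s m≤o) h = s≤s (n≤o∸m⇒m+n≤o m≤o h)

n≤m∧n≰m∸1⇒n≡m : ∀ {m n} → n ≤ m → ¬ n ≤ m ∸ 1 → n ≡ m
n≤m∧n≰m∸1⇒n≡m {zero} z≤n n≰ = ⊥-elim (n≰ z≤n)
n≤m∧n≰m∸1⇒n≡m {suc m} n≤m n≰ = ≤-antisym n≤m (≰⇒> n≰)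

module _ (G : Graph) where

  adj-flip : ∀ {u w b} → adj G u w ≡ b → adj G w u ≡ b
  adj-flip {u} {w} e = trans (adj-sym G w u) e

  Non-adj : ∀ {u w} → ¬ Adj G u w → adj G u w ≡ false
  Non-adj = Bool.¬-not

-- Makes every map of the pattern into G that preserves adjacency and non-adjacency injective.
Separated : ∀ {m} → (Fin m → Fin m → Bool) → Set
Separated H = ∀ i j → i ≡ j ⊎ H i j ≡ true ⊎ ∃ λ l → H i l ≢ H j l

IsPattern : ∀ {m} → (Fin m → Fin m → Bool) → Set
IsPattern H = (∀ i j → H i j ≡ H j i) × (∀ i → H i i ≡ false) × Separated H

isPattern? : ∀ {m} (H : Fin m → Fin m → Bool) → Dec (IsPattern H)
isPattern? H =
  all? (λ i → all? λ j → H i j Bool.≟ H j i)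
  ×-dec all? (λ i → H i i Bool.≟ false)
  ×-dec all? (λ i → all? λ j → i Fin.≟ j ⊎-dec H i j Bool.≟ true ⊎-dec any? λ l → ¬? (H i l Bool.≟ H j l))

S122-pattern : IsPattern S122
S122-pattern = toWitness {a? = isPattern? S122} tt

Net-pattern : IsPattern Net
Net-pattern = toWitness {a? = isPattern? Net} tt

induced : ∀ (G : Graph) {m} {H : Fin m → Fin m → Bool} → IsPattern H → (g : Fin m → V G)
  → (∀ i j → i Fin.< j → adj G (g i) (g j) ≡ H i j) → HasInduced G m H
induced G {H = H} (H-sym , H-irrefl , H-separated) g upper = g , injective , agree
  where
  agree : ∀ i j → adj G (g i) (g j) ≡ H i j
  agree i j with <-cmp i j
  ... | tri< i<j _ _ = upper i j i<j
  ... | tri≈ _ refl _ = trans (adj-irrefl G (g i)) (sym (H-irrefl i))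
  ... | tri> _ _ j<i = trans (adj-flip G (upper j i j<i)) (H-sym j i)

  injective : ∀ {i j} → g i ≡ g j → i ≡ j
  injective {i} {j} gi≡gj with H-separated i j
  ... | inj₁ i≡j = i≡j
  ... | inj₂ (inj₁ Hij) = ⊥-elim (Bool.not-¬ Hij (begin
          H i j            ≡⟨ sym (agree i j) ⟩
          adj G (g i) (g j) ≡⟨ cong (adj G (g i)) (sym gi≡gj) ⟩
          adj G (g i) (g i) ≡⟨ adj-irrefl G (g i) ⟩
          false            ∎))
    where open ≡-Reasoning
  ... | inj₂ (inj₂ (l , Hil≢Hjl)) =
          ⊥-elim (Hil≢Hjl (trans (sym (agree i l)) (trans (cong (λ u → adj G u (g l)) gi≡gj) (agree j l))))

module _ {r} (R : Fin 6 → Fin 6 → Set r) where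

  upper6 : R 0F 1F → R 0F 2F → R 0F 3F → R 0F 4F → R 0F 5F → R 1F 2F → R 1F 3F → R 1F 4F
    → R 1F 5F → R 2F 3F → R 2F 4F → R 2F 5F → R 3F 4F → R 3F 5F → R 4F 5F
    → ∀ i j → i Fin.< j → R i j
  upper6 r01 r02 r03 r04 r05 r12 r13 r14 r15 r23 r24 r25 r34 r35 r45 = go
    where
    go : ∀ i j → i Fin.< j → R i j
    go 0F 1F _ = r01
    go 0F 2F _ = r02
    go 0F 3F _ = r03
    go 0F 4F _ = r04
    go 0F 5F _ = r05
    go 1F 2F _ = r12
    go 1F 3F _ = r13
    go 1F 4F _ = r14
    go 1F 5F _ = r15
    go 2F 3F _ = r23
    go 2F 4F _ = r24
    go 2F 5F _ = r25
    go 3F 4F _ = r34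
    go 3F 5F _ = r35
    go 4F 5F _ = r45
    go _ 0F ()
    go (suc _) 1F (s≤s ())
    go (suc (suc _)) 2F (s≤s (s≤s ()))
    go (suc (suc (suc _))) 3F (s≤s (s≤s (s≤s ())))
    go (suc (suc (suc (suc _)))) 4F (s≤s (s≤s (s≤s (s≤s ()))))
    go (suc (suc (suc (suc (suc _))))) 5F (s≤s (s≤s (s≤s (s≤s (s≤s ())))))

record InducedP4 (G : Graph) (p₀ p₁ p₂ p₃ : V G) : Set where
  field
    p₀p₁ : Adj G p₀ p₁
    p₁p₂ : Adj G p₁ p₂
    p₂p₃ : Adj G p₂ p₃
    p₀≁p₂ : adj G p₀ p₂ ≡ false
    p₀≁p₃ : adj G p₀ p₃ ≡ false
    p₁≁p₃ : adj G p₁ p₃ ≡ false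

InducedP4-reverse : ∀ {G p₀ p₁ p₂ p₃} → InducedP4 G p₀ p₁ p₂ p₃ → InducedP4 G p₃ p₂ p₁ p₀
InducedP4-reverse {G} P = record
  { p₀p₁ = adj-flip G p₂p₃ ; p₁p₂ = adj-flip G p₁p₂ ; p₂p₃ = adj-flip G p₀p₁
  ; p₀≁p₂ = adj-flip G p₁≁p₃ ; p₀≁p₃ = adj-flip G p₀≁p₃ ; p₁≁p₃ = adj-flip G p₀≁p₂ }
  where open InducedP4 P

module Configurations {G : Graph} (free : S122N-free G) {p₀ p₁ p₂ p₃ w t : V G}
  (wt : Adj G w t) (t≁p₀ : adj G t p₀ ≡ false) (t≁p₁ : adj G t p₁ ≡ false)
  (t≁p₂ : adj G t p₂ ≡ false) (t≁p₃ : adj G t p₃ ≡ false) where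

  S122-at-path-vertex : InducedP4 G p₀ p₁ p₂ p₃
    → Adj G w p₁ → adj G w p₀ ≡ false → adj G w p₂ ≡ false → adj G w p₃ ≡ false → ⊥
  S122-at-path-vertex P wp₁ w≁p₀ w≁p₂ w≁p₃ =
    proj₁ free (induced G S122-pattern g (upper6 (λ i j → adj G (g i) (g j) ≡ S122 i j)
      (adj-flip G p₀p₁) p₁p₂ p₁≁p₃ (adj-flip G wp₁) (adj-flip G t≁p₁)
      p₀≁p₂ p₀≁p₃ (adj-flip G w≁p₀) (adj-flip G t≁p₀)
      p₂p₃ (adj-flip G w≁p₂) (adj-flip G t≁p₂)
      (adj-flip G w≁p₃) (adj-flip G t≁p₃)
      wt))
    where
    open InducedP4 P
    g : Fin 6 → V G
    g = lookup (p₁ ∷ p₀ ∷ p₂ ∷ p₃ ∷ w ∷ t ∷ [])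

  Net-at-path-edge : InducedP4 G p₀ p₁ p₂ p₃
    → Adj G w p₁ → Adj G w p₂ → adj G w p₀ ≡ false → adj G w p₃ ≡ false → ⊥
  Net-at-path-edge P wp₁ wp₂ w≁p₀ w≁p₃ =
    proj₂ free (induced G Net-pattern g (upper6 (λ i j → adj G (g i) (g j) ≡ Net i j)
      wp₁ wp₂ wt w≁p₀ w≁p₃
      p₁p₂ (adj-flip G t≁p₁) (adj-flip G p₀p₁) p₁≁p₃
      (adj-flip G t≁p₂) (adj-flip G p₀≁p₂) p₂p₃
      t≁p₀ t≁p₃
      p₀≁p₃))
    where
    open InducedP4 P
    g : Fin 6 → V G
    g = lookup (w ∷ p₁ ∷ p₂ ∷ t ∷ p₀ ∷ p₃ ∷ [])

  S122-at-bypass : ∀ {p₄} → InducedP4 G p₀ p₁ p₂ p₃ → InducedP4 G p₁ p₂ p₃ p₄ → adj G p₀ p₄ ≡ false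
    → adj G t p₄ ≡ false
    → Adj G w p₁ → Adj G w p₃ → adj G w p₀ ≡ false → adj G w p₄ ≡ false → ⊥
  S122-at-bypass {p₄} P Q p₀≁p₄ t≁p₄ wp₁ wp₃ w≁p₀ w≁p₄ =
    proj₁ free (induced G S122-pattern g (upper6 (λ i j → adj G (g i) (g j) ≡ S122 i j)
      wt wp₁ w≁p₀ wp₃ w≁p₄
      t≁p₁ t≁p₀ t≁p₃ t≁p₄
      (adj-flip G (InducedP4.p₀p₁ P)) (InducedP4.p₁≁p₃ P) (InducedP4.p₀≁p₃ Q)
      (InducedP4.p₀≁p₃ P) p₀≁p₄
      (InducedP4.p₂p₃ Q)))
    where
    g : Fin 6 → V G
    g = lookup (w ∷ t ∷ p₁ ∷ p₀ ∷ p₃ ∷ p₄ ∷ [])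

_▷_ : ∀ {G u w t l} → Walk G u w l → Adj G w t → Walk G u t (suc l)
nil ▷ e = cons e nil
cons e′ W ▷ e = cons e′ (W ▷ e)

_++ʷ_ : ∀ {G u w t l l′} → Walk G u w l → Walk G w t l′ → Walk G u t (l + l′)
nil ++ʷ W′ = W′
cons e W ++ʷ W′ = cons e (W ++ʷ W′)

module ShortestPath {G : Graph} {x y : V G} {k : ℕ} {v : ℕ → V G} (sp : IsShortestPath G x y k v) where
  open PathSets G k v

  edge : ∀ i → suc i ≤ k → Adj G (v i) (v (suc i))
  edge = proj₁ (proj₂ (proj₂ sp))

  v-injective : ∀ {i j} → i ≤ k → j ≤ k → v i ≡ v j → i ≡ j
  v-injective {i} {j} = proj₁ (proj₂ (proj₂ (proj₂ sp))) i j

  v-≢ : ∀ {i j} → i ≤ k → j ≤ k → i ≢ j → v i ≢ v j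
  v-≢ i≤k j≤k i≢j = i≢j ∘′ v-injective i≤k j≤k

  shortest : ∀ {l} → Walk G (v 0) (v k) l → k ≤ l
  shortest {l} W = proj₂ (proj₂ (proj₂ (proj₂ sp))) l (subst₂ (λ s e → Walk G s e l) (proj₁ sp) (proj₁ (proj₂ sp)) W)

  from-start : ∀ a → a ≤ k → Walk G (v 0) (v a) a
  from-start zero _ = nil
  from-start (suc a) h = from-start a (<⇒≤ h) ▷ edge a h

  along : ∀ a d → d + a ≤ k → Walk G (v a) (v (d + a)) d
  along a zero _ = nil
  along a (suc d) h = along a d (<⇒≤ h) ▷ edge (d + a) h

  to-end : ∀ b → b ≤ k → Walk G (v b) (v k) (k ∸ b)
  to-end b b≤k = subst (λ e → Walk G (v b) (v e) (k ∸ b)) (m∸n+n≡m b≤k)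
    (along b (k ∸ b) (≤-reflexive (m∸n+n≡m b≤k)))

  walk-index-bound : ∀ {a b c} → a ≤ k → b ≤ k → Walk G (v a) (v b) c → b ≤ c + a
  walk-index-bound {a} {b} {c} a≤k b≤k W = +-cancelʳ-≤ (k ∸ b) b (c + a) (begin
    b + (k ∸ b)       ≡⟨ m+[n∸m]≡n b≤k ⟩
    k                 ≤⟨ shortest (from-start a a≤k ++ʷ (W ++ʷ to-end b b≤k)) ⟩
    a + (c + (k ∸ b)) ≡⟨ sym (+-assoc a c (k ∸ b)) ⟩
    a + c + (k ∸ b)   ≡⟨ cong (_+ (k ∸ b)) (+-comm a c) ⟩
    c + a + (k ∸ b)   ∎)
    where open ≤-Reasoning

  4≤length : DistAtLeast G x y 4 → 4 ≤ k
  4≤length dist = dist k (subst₂ (λ s e → Walk G s e k) (proj₁ sp) (proj₁ (proj₂ sp)) (from-start k ≤-refl))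

  no-chord : ∀ {a b} → 2 + a ≤ b → b ≤ k → adj G (v a) (v b) ≡ false
  no-chord {a} {b} 2+a≤b b≤k = Non-adj G λ e →
    <-irrefl refl (≤-trans 2+a≤b (walk-index-bound (≤-trans (m≤n+m a 2) (≤-trans 2+a≤b b≤k)) b≤k (cons e nil)))

  common-nbr-span : ∀ {w a b} → a ≤ k → b ≤ k → Adj G w (v a) → Adj G w (v b) → b ≤ 2 + a
  common-nbr-span a≤k b≤k wa wb = walk-index-bound a≤k b≤k (cons (adj-flip G wa) (cons wb nil))

  far-nbr : ∀ {w a b} → 3 + a ≤ b → b ≤ k → Adj G w (v a) → adj G w (v b) ≡ false
  far-nbr {a = a} 3+a≤b b≤k wa = Non-adj G λ wb →
    <-irrefl refl (≤-trans 3+a≤b (common-nbr-span (≤-trans (m≤n+m a 3) (≤-trans 3+a≤b b≤k)) b≤k wa wb))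

  far-nbr⁻ : ∀ {w a b} → 3 + a ≤ b → b ≤ k → Adj G w (v b) → adj G w (v a) ≡ false
  far-nbr⁻ {a = a} 3+a≤b b≤k wb = Non-adj G λ wa → Bool.not-¬ (far-nbr 3+a≤b b≤k wa) wb

  window : ∀ {j} → 3 + j ≤ k → InducedP4 G (v j) (v (1 + j)) (v (2 + j)) (v (3 + j))
  window {j} h = record
    { p₀p₁ = edge j (<⇒≤ (<⇒≤ h)) ; p₁p₂ = edge (1 + j) (<⇒≤ h) ; p₂p₃ = edge (2 + j) h
    ; p₀≁p₂ = no-chord ≤-refl (<⇒≤ h) ; p₀≁p₃ = no-chord (m≤n+m (2 + j) 1) h ; p₁≁p₃ = no-chord ≤-refl h }

  Remote : V G → Set
  Remote t = ∀ i → i ≤ k → adj G t (v i) ≡ false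

  S⊎Remote : ∀ t → S t ⊎ Remote t
  S⊎Remote t with anyUpTo? (λ i → v i Fin.≟ t) (suc k)
  ... | yes (i , s≤s i≤k , vi≡t) = inj₁ (inj₁ (i , i≤k , vi≡t))
  ... | no t∉P with anyUpTo? (λ i → adj G t (v i) Bool.≟ true) (suc k)
  ...   | yes (i , s≤s i≤k , ti) = inj₁ (inj₂ ((λ (j , j≤k , vj≡t) → t∉P (j , s≤s j≤k , vj≡t)) , v i , (i , i≤k , refl) , ti))
  ...   | no no-nbr = inj₂ λ i i≤k → Non-adj G λ ti → no-nbr (i , s≤s i≤k , ti)

  NG⊆S-unless-remote : ∀ {X : VSet} → (∀ {z t} → X z → Adj G z t → Remote t → ⊥) → NG X ⊆ S
  NG⊆S-unless-remote no-remote t (_ , z , Xz , tz) with S⊎Remote t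
  ... | inj₁ St = St
  ... | inj₂ t-remote = ⊥-elim (no-remote Xz (adj-flip G tz) t-remote)

  R⇒Remote : ∀ {t} → R t → Remote t
  R⇒Remote {t} Rt with S⊎Remote t
  ... | inj₁ St = ⊥-elim (Rt St)
  ... | inj₂ t-remote = t-remote

  NPis-intro : ∀ {z X} → ¬ OnP z → (∀ i → i ≤ k → Adj G z (v i) → X (v i))
    → (∀ u → X u → OnP u × Adj G z u) → NPis z X
  NPis-intro z∉P sound complete = z∉P , λ u → (λ { ((i , i≤k , refl) , zu) → sound i i≤k zu }) , complete u

  NPis-adj : ∀ {z X u} → NPis z X → X u → Adj G z u
  NPis-adj (_ , nbrs) Xu = proj₂ (proj₂ (nbrs _) Xu)

  NPis-nonadj : ∀ {z X i} → NPis z X → i ≤ k → ¬ X (v i) → adj G z (v i) ≡ false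
  NPis-nonadj (_ , nbrs) i≤k ¬Xvi = Non-adj G λ zi → ¬Xvi (proj₁ (nbrs _) ((_ , i≤k , refl) , zi))

  P-nbr-∉R : ∀ {w t} → OnP w → Adj G w t → ¬ R t
  P-nbr-∉R w∈P wt Rt = Rt (inj₂ ((λ t∈P → Rt (inj₁ t∈P)) , _ , w∈P , adj-flip G wt))

  data PathNbrhood (w : V G) : Set where
    in-A : ∀ a → a ≤ k → A a w → PathNbrhood w
    in-M : ∀ a → 1 + a ≤ k → M (1 + a) w → PathNbrhood w
    in-L : ∀ a → 2 + a ≤ k → L (1 + a) w → PathNbrhood w
    in-N : ∀ a → 2 + a ≤ k → N (1 + a) w → PathNbrhood w

  -- The neighbours of w on P lie within three consecutive vertices, starting from the first one.
  classify : ∀ {w u} → ¬ OnP w → u ≤ k → Adj G w (v u) → PathNbrhood w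
  classify {w} w∉P u≤k wu with least (λ i → adj G w (v i) Bool.≟ true) wu
  ... | a , a≤u , wa , below = shape (hit? (1 + a)) (hit? (2 + a))
    where
    a≤k : a ≤ k
    a≤k = ≤-trans a≤u u≤k

    Hit : ℕ → Set
    Hit i = i ≤ k × Adj G w (v i)

    hit? : ∀ i → Dec (Hit i)
    hit? i = i ≤? k ×-dec adj G w (v i) Bool.≟ true

    on-P : ∀ {i} → Hit i → OnP (v i) × Adj G w (v i)
    on-P (i≤k , wi) = (_ , i≤k , refl) , wi

    nbrs-within : ∀ {X : VSet} → X (v a) → (Hit (1 + a) → X (v (1 + a))) → (Hit (2 + a) → X (v (2 + a)))
      → (∀ u → X u → OnP u × Adj G w u) → NPis w X
    nbrs-within {X} Xa X₁ X₂ = NPis-intro w∉P sound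
      where
      sound : ∀ i → i ≤ k → Adj G w (v i) → X (v i)
      sound i i≤k wi with m≤n≤2+m (≮⇒≥ λ i<a → below i<a wi) (common-nbr-span a≤k i≤k wa wi)
      ... | inj₁ refl = Xa
      ... | inj₂ (inj₁ refl) = X₁ (i≤k , wi)
      ... | inj₂ (inj₂ refl) = X₂ (i≤k , wi)

    shape : Dec (Hit (1 + a)) → Dec (Hit (2 + a)) → PathNbrhood w
    shape (no ¬h₁) (no ¬h₂) = in-A a a≤k (nbrs-within refl (⊥-elim ∘′ ¬h₁) (⊥-elim ∘′ ¬h₂)
      λ { _ refl → on-P (a≤k , wa) })
    shape (yes h₁) (no ¬h₂) = in-M a (proj₁ h₁) (nbrs-within (inj₁ refl) (λ _ → inj₂ refl) (⊥-elim ∘′ ¬h₂)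
      λ { _ (inj₁ refl) → on-P (a≤k , wa) ; _ (inj₂ refl) → on-P h₁ })
    shape (no ¬h₁) (yes h₂) = in-L a (proj₁ h₂) (nbrs-within (inj₁ refl) (⊥-elim ∘′ ¬h₁) (λ _ → inj₂ refl)
      λ { _ (inj₁ refl) → on-P (a≤k , wa) ; _ (inj₂ refl) → on-P h₂ })
    shape (yes h₁) (yes h₂) = in-N a (proj₁ h₂) (nbrs-within (inj₁ refl) (λ _ → inj₂ (inj₁ refl)) (λ _ → inj₂ (inj₂ refl))
      λ { _ (inj₁ refl) → on-P (a≤k , wa) ; _ (inj₂ (inj₁ refl)) → on-P h₁ ; _ (inj₂ (inj₂ refl)) → on-P h₂ })

module S122NFree {G : Graph} (free : S122N-free G) {x y : V G} {k : ℕ} {v : ℕ → V G}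
  (sp : IsShortestPath G x y k v) (dist : DistAtLeast G x y 4) where
  open PathSets G k v
  open ShortestPath sp

  module _ {w t : V G} (wt : Adj G w t) (remote : Remote t) where

    private
      module Forward {j} (h : 3 + j ≤ k) = Configurations {G = G} free wt
        (remote j (m+n≤o⇒n≤o 3 h)) (remote (1 + j) (m+n≤o⇒n≤o 2 h)) (remote (2 + j) (m+n≤o⇒n≤o 1 h)) (remote (3 + j) h)
      module Backward {j} (h : 3 + j ≤ k) = Configurations {G = G} free wt
        (remote (3 + j) h) (remote (2 + j) (m+n≤o⇒n≤o 1 h)) (remote (1 + j) (m+n≤o⇒n≤o 2 h)) (remote j (m+n≤o⇒n≤o 3 h))

    no-pendant : ∀ {j} → 3 + j ≤ k → Adj G w (v (1 + j))
      → adj G w (v j) ≡ false → adj G w (v (2 + j)) ≡ false → adj G w (v (3 + j)) ≡ false → ⊥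
    no-pendant h = Forward.S122-at-path-vertex h (window h)

    no-pendant-reversed : ∀ {j} → 3 + j ≤ k → Adj G w (v (2 + j))
      → adj G w (v (3 + j)) ≡ false → adj G w (v (1 + j)) ≡ false → adj G w (v j) ≡ false → ⊥
    no-pendant-reversed h = Backward.S122-at-path-vertex h (InducedP4-reverse (window h))

    no-net : ∀ {j} → 3 + j ≤ k → Adj G w (v (1 + j)) → Adj G w (v (2 + j))
      → adj G w (v j) ≡ false → adj G w (v (3 + j)) ≡ false → ⊥
    no-net h = Forward.Net-at-path-edge h (window h)

    no-bypass : ∀ {j} → 4 + j ≤ k → Adj G w (v (1 + j)) → Adj G w (v (3 + j))
      → adj G w (v j) ≡ false → adj G w (v (4 + j)) ≡ false → ⊥
    no-bypass {j} h = Forward.S122-at-bypass (<⇒≤ h) (window (<⇒≤ h)) (window h)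
      (no-chord (m≤n+m (2 + j) 2) h) (remote (4 + j) h)

  4≤k : 4 ≤ k
  4≤k = 4≤length dist

  -- For i ≥ 2 the legs of the S_{1,2,2} point towards v₀, since v_{i+2} need not exist.
  A-no-remote-nbr : ∀ {i z t} → 1 ≤ i → i ≤ k ∸ 1 → A i z → Adj G z t → Remote t → ⊥
  A-no-remote-nbr {1} _ _ zA zt remote =
    no-pendant zt remote h (NPis-adj zA refl)
      (NPis-nonadj zA (m+n≤o⇒n≤o 3 h) (v-≢ (m+n≤o⇒n≤o 3 h) (m+n≤o⇒n≤o 2 h) λ ()))
      (NPis-nonadj zA (m+n≤o⇒n≤o 1 h) (v-≢ (m+n≤o⇒n≤o 1 h) (m+n≤o⇒n≤o 2 h) λ ()))
      (NPis-nonadj zA h (v-≢ h (m+n≤o⇒n≤o 2 h) λ ()))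
    where
    h : 3 ≤ k
    h = m+n≤o⇒n≤o 1 4≤k
  A-no-remote-nbr {suc (suc j)} _ i≤k∸1 zA zt remote =
    no-pendant-reversed zt remote h (NPis-adj zA refl)
      (NPis-nonadj zA h (v-≢ h (m+n≤o⇒n≤o 1 h) λ ()))
      (NPis-nonadj zA (m+n≤o⇒n≤o 2 h) (v-≢ (m+n≤o⇒n≤o 2 h) (m+n≤o⇒n≤o 1 h) λ ()))
      (NPis-nonadj zA (m+n≤o⇒n≤o 3 h) (v-≢ (m+n≤o⇒n≤o 3 h) (m+n≤o⇒n≤o 1 h) λ ()))
    where
    h : 3 + j ≤ k
    h = n≤o∸m⇒m+n≤o (m+n≤o⇒n≤o 3 4≤k) i≤k∸1

  M-no-remote-nbr : ∀ {i z t} → 2 ≤ i → i ≤ k ∸ 1 → M i z → Adj G z t → Remote t → ⊥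
  M-no-remote-nbr {suc (suc j)} (s≤s (s≤s z≤n)) i≤k∸1 zM zt remote =
    no-net zt remote h (NPis-adj zM (inj₁ refl)) (NPis-adj zM (inj₂ refl))
      (NPis-nonadj zM (m+n≤o⇒n≤o 3 h)
        [ v-≢ (m+n≤o⇒n≤o 3 h) (m+n≤o⇒n≤o 2 h) (λ ()) , v-≢ (m+n≤o⇒n≤o 3 h) (m+n≤o⇒n≤o 1 h) (λ ()) ])
      (NPis-nonadj zM h [ v-≢ h (m+n≤o⇒n≤o 2 h) (λ ()) , v-≢ h (m+n≤o⇒n≤o 1 h) (λ ()) ])
    where
    h : 3 + j ≤ k
    h = n≤o∸m⇒m+n≤o (m+n≤o⇒n≤o 3 4≤k) i≤k∸1

  N-no-remote-nbr : ∀ {i z t} → 2 ≤ i → i ≤ k ∸ 2 → N i z → Adj G z t → Remote t → ⊥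
  N-no-remote-nbr {suc (suc j)} {z} (s≤s (s≤s z≤n)) i≤k∸2 zN zt remote =
    no-bypass zt remote h z₁ z₃ (far-nbr⁻ ≤-refl (m+n≤o⇒n≤o 1 h) z₃) (far-nbr ≤-refl h z₁)
    where
    h : 4 + j ≤ k
    h = n≤o∸m⇒m+n≤o (m+n≤o⇒n≤o 2 4≤k) i≤k∸2
    z₁ : Adj G z (v (1 + j))
    z₁ = NPis-adj zN (inj₁ refl)
    z₃ : Adj G z (v (3 + j))
    z₃ = NPis-adj zN (inj₂ (inj₂ refl))

  -- The S_{1,2,2} is centred at v₂ for L₁, at z for L₂, and at v_{i-1} for L_i with i ≥ 3.
  L-no-remote-nbr : ∀ {i z t} → 1 ≤ i → i ≤ k ∸ 1 → L i z → Adj G z t → Remote t → ⊥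
  L-no-remote-nbr {1} {z} _ _ zL zt remote =
    no-pendant zt remote 4≤k (NPis-adj zL (inj₂ refl))
      (NPis-nonadj zL 1≤k [ v-≢ 1≤k z≤n (λ ()) , v-≢ 1≤k (m+n≤o⇒n≤o 2 4≤k) (λ ()) ])
      (far-nbr ≤-refl (m+n≤o⇒n≤o 1 4≤k) z₀)
      (far-nbr (s≤s (s≤s (s≤s z≤n))) 4≤k z₀)
    where
    1≤k : 1 ≤ k
    1≤k = m+n≤o⇒n≤o 3 4≤k
    z₀ : Adj G z (v 0)
    z₀ = NPis-adj zL (inj₁ refl)
  L-no-remote-nbr {2} {z} _ _ zL zt remote =
    no-bypass zt remote 4≤k z₁ z₃ (far-nbr⁻ ≤-refl (m+n≤o⇒n≤o 1 4≤k) z₃) (far-nbr ≤-refl 4≤k z₁)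
    where
    z₁ : Adj G z (v 1)
    z₁ = NPis-adj zL (inj₁ refl)
    z₃ : Adj G z (v 3)
    z₃ = NPis-adj zL (inj₂ refl)
  L-no-remote-nbr {suc (suc (suc j))} {z} _ i≤k∸1 zL zt remote =
    no-pendant-reversed zt remote (<⇒≤ h) z₂
      (NPis-nonadj zL (<⇒≤ h) [ v-≢ (<⇒≤ h) (m+n≤o⇒n≤o 2 h) (λ ()) , v-≢ (<⇒≤ h) h (λ ()) ])
      (far-nbr⁻ ≤-refl h z₄)
      (far-nbr⁻ (m≤n+m (3 + j) 1) h z₄)
    where
    h : 4 + j ≤ k
    h = n≤o∸m⇒m+n≤o (m+n≤o⇒n≤o 3 4≤k) i≤k∸1
    z₂ : Adj G z (v (2 + j))
    z₂ = NPis-adj zL (inj₁ refl)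
    z₄ : Adj G z (v (4 + j))
    z₄ = NPis-adj zL (inj₂ refl)

  R-nbr-in-S : ∀ w → S w → NG R w → A 0 w ⊎ M 1 w ⊎ N 1 w ⊎ N (k ∸ 1) w ⊎ M k w ⊎ A k w
  R-nbr-in-S w (inj₁ w∈P) (_ , t , Rt , wt) = ⊥-elim (P-nbr-∉R w∈P wt Rt)
  R-nbr-in-S w (inj₂ (w∉P , _ , (u , u≤k , refl) , wu)) (_ , t , Rt , wt) = at-ends (classify w∉P u≤k wu)
    where
    remote : Remote t
    remote = R⇒Remote Rt

    at-ends : PathNbrhood w → A 0 w ⊎ M 1 w ⊎ N 1 w ⊎ N (k ∸ 1) w ⊎ M k w ⊎ A k w
    at-ends (in-A zero _ w∈A) = inj₁ w∈A
    at-ends (in-A (suc a) a≤k w∈A) with suc a ≤? k ∸ 1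
    ... | yes inner = ⊥-elim (A-no-remote-nbr (s≤s z≤n) inner w∈A wt remote)
    ... | no ¬inner = inj₂ (inj₂ (inj₂ (inj₂ (inj₂ (subst (λ i → A i w) (n≤m∧n≰m∸1⇒n≡m a≤k ¬inner) w∈A)))))
    at-ends (in-M zero _ w∈M) = inj₂ (inj₁ w∈M)
    at-ends (in-M (suc a) i≤k w∈M) with 2 + a ≤? k ∸ 1
    ... | yes inner = ⊥-elim (M-no-remote-nbr (s≤s (s≤s z≤n)) inner w∈M wt remote)
    ... | no ¬inner = inj₂ (inj₂ (inj₂ (inj₂ (inj₁ (subst (λ i → M i w) (n≤m∧n≰m∸1⇒n≡m i≤k ¬inner) w∈M)))))
    at-ends (in-L a 2+a≤k w∈L) = ⊥-elim (L-no-remote-nbr (s≤s z≤n) (m+n≤o⇒n≤o∸m 1 2+a≤k) w∈L wt remote)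
    at-ends (in-N zero _ w∈N) = inj₂ (inj₂ (inj₁ w∈N))
    at-ends (in-N (suc a) 3+a≤k w∈N) with 2 + a ≤? k ∸ 2
    ... | yes inner = ⊥-elim (N-no-remote-nbr (s≤s (s≤s z≤n)) inner w∈N wt remote)
    ... | no ¬inner = inj₂ (inj₂ (inj₂ (inj₁ (subst (λ i → N i w) i≡k∸1 w∈N))))
      where
      i≡k∸1 : 2 + a ≡ k ∸ 1
      i≡k∸1 = n≤m∧n≰m∸1⇒n≡m (m+n≤o⇒n≤o∸m 1 3+a≤k) (¬inner ∘′ subst (2 + a ≤_) (∸-+-assoc k 1 1))

lemma1 : (G : Graph) → S122N-free G → (x y : V G) → DistAtLeast G x y 4
    → (k : ℕ) (v : ℕ → V G) → IsShortestPath G x y k v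
    → let open PathSets G k v in
      (∀ i → 2 ≤ i → i ≤ k ∸ 1 → NG (M i) ⊆ S)
      × (∀ i → 2 ≤ i → i ≤ k ∸ 2 → NG (N i) ⊆ S)
      × (∀ i → 1 ≤ i → i ≤ k ∸ 1 → NG (L i) ⊆ S)
      × (∀ w → OnP w → NG R w → ⊥)
      × (∀ w → S w → NG R w
           → A 0 w ⊎ M 1 w ⊎ N 1 w ⊎ N (k ∸ 1) w ⊎ M k w ⊎ A k w)
lemma1 G free x y dist k v sp =
    (λ i 2≤i i≤k∸1 → NG⊆S-unless-remote (M-no-remote-nbr 2≤i i≤k∸1))
  , (λ i 2≤i i≤k∸2 → NG⊆S-unless-remote (N-no-remote-nbr 2≤i i≤k∸2))
  , (λ i 1≤i i≤k∸1 → NG⊆S-unless-remote (L-no-remote-nbr 1≤i i≤k∸1))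
  , (λ w w∈P (_ , t , Rt , wt) → P-nbr-∉R w∈P wt Rt)
  , R-nbr-in-S
  where
  open ShortestPath sp
  open S122NFree free sp dist
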